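{- Let $I$ be an instance and $v$ a variety. A solid of variety $v$ is composable from $I$ if and only if the number of cubes of variety $v$ in $I$ is at least the number of connected components of the multigraph $G_v$ that are trees (isolated vertices included).
   Context: Fix a palette of six distinct colors, totally ordered. A (colored) cube is a unit cube each of whose six faces is painted with exactly one color of the palette, all six faces receiving different colors. Two colored cubes have the same variety if one can be rotated onto the other (30 varieties). An instance is a finite multiset of colored cubes. A solid is a $2\times2\times2$ cube assembled from eight colored unit cubes such that each of its six outer $2\times2$ faces is of a single color and the six outer faces have six different colors; its variety is defined as for unit cubes. A solid of variety $v$ is composable from $I$ if some eight cubes of $I$ can be placed and oriented to form a solid of variety $v$. For a corner of a cube, its corner triple is the ordered triple of the three colors of the faces meeting at that corner, listed in clockwise order around the corner and cyclically rotated so that the smallest color comes first; $T_v$ denotes the set of eight corner triples of variety $v$. Two different varieties are compatible if they share at least one corner triple; it is known that two different varieties share either zero or exactly two corner triples. $G_v$ is the multigraph with vertex set $T_v$ having, for each cube $c$ of $I$ (counted with multiplicity) whose variety is compatible with $v$, one edge joining the two elements of $T_v$ that are corner triples of $c$'s variety. -}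

module Defs where

open import Data.Nat using (ℕ; zero; suc; _<ᵇ_; _≤_)
open import Data.Fin using (Fin; toℕ; inject₁; fromℕ) renaming (zero to fzero; suc to fsuc)
open import Data.Bool using (Bool; true; false; if_then_else_; _∧_)
open import Data.Product using (Σ; _×_; _,_; proj₁; proj₂; ∃)
open import Data.List using (List; []; _∷_; length; lookup)
open import Relation.Binary.PropositionalEquality using (_≡_; _≢_)
open import Relation.Nullary using (¬_)
open import Function.Definitions using (Injective)
open import Relation.Binary.Construct.Closure.ReflexiveTransitive using (Star)

Color : Set
Color = Fin 6

-- Geometry of a unit cube in a right-handed coordinate system.
-- A face is given by an axis and a sign: (X , pos) is the face with
-- outward normal +x, etc.

data Axis : Set where
  X Y Z : Axis

data Sign : Set where
  pos neg : Sign

flip : Sign → Sign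
flip pos = neg
flip neg = pos

Face : Set
Face = Axis × Sign

record Cube : Set where
  constructor cube
  field
    color     : Face → Color
    color-inj : Injective _≡_ _≡_ color
open Cube public

-- The rotation group of the cube is generated by the
-- quarter turn about the z-axis (x ↦ y, y ↦ -x) and the quarter turn
-- about the x-axis (y ↦ z, z ↦ -y).

data Gen : Set where
  rz rx : Gen

genAct : Gen → Face → Face
genAct rz (X , s) = (Y , s)
genAct rz (Y , s) = (X , flip s)
genAct rz (Z , s) = (Z , s)
genAct rx (X , s) = (X , s)
genAct rx (Y , s) = (Z , s)
genAct rx (Z , s) = (Y , flip s)

Rotation : Set
Rotation = List Gen

act : Rotation → Face → Face
act []      f = f
act (g ∷ r) f = genAct g (act r f)

SameVariety : Cube → Cube → Set
SameVariety c d = Σ Rotation λ r → ∀ (f : Face) → color d f ≡ color c (act r f)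

-- A corner is given by a sign for each axis; the faces meeting at corner
-- (sx , sy , sz) are (X , sx), (Y , sy), (Z , sz).  Viewed from outside,
-- at the corner (+,+,+) the clockwise order of the faces is x, z, y;
-- each sign change reverses the orientation.

Corner : Set
Corner = Sign × Sign × Sign

evenCorner : Corner → Bool
evenCorner (sx , sy , sz) = par sx (par sy (par sz true))
  where
  par : Sign → Bool → Bool
  par pos b = b
  par neg true = false
  par neg false = true

Triple : Set
Triple = Color × Color × Color

_<c_ : Color → Color → Bool
a <c b = toℕ a <ᵇ toℕ b

normalize : Triple → Triple
normalize (a , b , c) =
  if (a <c b) ∧ (a <c c) then (a , b , c)
  else if (b <c a) ∧ (b <c c) then (b , c , a)
  else (c , a , b)

clockwise : Cube → Corner → Triple
clockwise q (sx , sy , sz) =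
  if evenCorner (sx , sy , sz)
  then (color q (X , sx) , color q (Z , sz) , color q (Y , sy))
  else (color q (X , sx) , color q (Y , sy) , color q (Z , sz))

cornerTriple : Cube → Corner → Triple
cornerTriple q k = normalize (clockwise q k)

InT : Triple → Cube → Set
InT t q = Σ Corner λ k → cornerTriple q k ≡ t

Compatible : Cube → Cube → Set
Compatible c d = ¬ SameVariety c d × (Σ Triple λ t → InT t c × InT t d)

-- Instances: finite multisets of cubes, represented as lists.

Instance : Set
Instance = List Cube

Idx : Instance → Set
Idx I = Fin (length I)

-- The variety v is given by a representative cube v.
-- Vertices: the elements of T_v, indexed by the corners of v
-- (corner k of v ↦ cornerTriple v k; the eight triples are distinct).
-- Edges: one for each index i of I whose cube is compatible with v;
-- edge i joins the two (distinct) vertices that are corner triples of I[i].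

Joins : (I : Instance) (v : Cube) → Idx I → Corner → Corner → Set
Joins I v i k k' =
  Compatible v (lookup I i) × k ≢ k'
  × InT (cornerTriple v k) (lookup I i) × InT (cornerTriple v k') (lookup I i)

Adj : (I : Instance) (v : Cube) → Corner → Corner → Set
Adj I v k k' = Σ (Idx I) λ i → Joins I v i k k'

Conn : (I : Instance) (v : Cube) → Corner → Corner → Set
Conn I v = Star (Adj I v)

record Cycle (I : Instance) (v : Cube) : Set where
  field
    m       : ℕ
    m≥1     : 1 ≤ m
    vs      : Fin (suc m) → Corner
    es      : Fin (suc m) → Idx I
    vs-inj  : Injective _≡_ _≡_ vs
    es-inj  : Injective _≡_ _≡_ es
    step    : ∀ (j : Fin m) → Joins I v (es (inject₁ j)) (vs (inject₁ j)) (vs (fsuc j))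
    close   : Joins I v (es (fromℕ m)) (vs (fromℕ m)) (vs fzero)

-- The connected component of G_v containing vertex k is a tree
-- (connected by construction, and acyclic: no cycle passes through it).
-- Isolated vertices are trees.
InTreeComponent : (I : Instance) (v : Cube) → Corner → Set
InTreeComponent I v k = ¬ (Σ (Cycle I v) λ C → Conn I v k (Cycle.vs C fzero))

-- Solids.  Positions in the 2×2×2 cube are given by a sign per axis;
-- position p has face (a , s) on the outside iff p's a-coordinate is s.

Position : Set
Position = Sign × Sign × Sign

coord : Position → Axis → Sign
coord (sx , sy , sz) X = sx
coord (sx , sy , sz) Y = sy
coord (sx , sy , sz) Z = sz

Exposed : Position → Face → Set
Exposed p (a , s) = coord p a ≡ s

-- A solid of variety v is composable from I: eight distinct cubes of I
-- (idx injective), each placed in a position in some orientation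
-- (placed p is a rotation of I[idx p]), such that the outer faces form
-- a colouring S of the big cube with each outer 2×2 face of one colour,
-- six different colours (S is a Cube), and S has variety v.
Composable : Instance → Cube → Set
Composable I v =
  Σ (Position → Idx I) λ idx →
  Σ (Position → Cube) λ placed →
  Σ Cube λ S →
    Injective _≡_ _≡_ idx
    × (∀ p → SameVariety (lookup I (idx p)) (placed p))
    × (∀ p f → Exposed p f → color (placed p) f ≡ color S f)
    × SameVariety S v

-- "#(cubes of variety v in I) ≥ #(tree components of G_v)":
-- an assignment to each vertex lying in a tree component of a cube of I
-- of variety v, such that vertices in different components receive
-- different cubes (index positions in I).  Such an assignment exists iff
-- there is an injection from the set of tree components into the set of
-- cubes of variety v in I (counted with multiplicity).

TreeComponentsFit : Instance → Cube → Set
TreeComponentsFit I v =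
  Σ ((k : Corner) → InTreeComponent I v k → Idx I) λ f →
    (∀ k t → SameVariety (lookup I (f k t)) v)
    × (∀ k t k' t' → f k t ≡ f k' t' → Conn I v k k')

{-# OPTIONS --safe #-}
module Submission where

-- A solid of variety v is the same as an injective choice, for every corner u of v, of a cube of I
-- carrying the corner triple of u: the chosen cube is rotated so that its corner shows the three
-- faces of u.  A cube carrying a corner triple of v is either of variety v or carries exactly one
-- further triple of v, i.e. it is an edge of G_v.  Such a choice therefore lets every vertex pick
-- either a cube of variety v or an incident edge, injectively.  Starting at a vertex of a tree
-- component and following the picked edges can never close a cycle, so it reaches a cube of variety v.
-- Conversely, orient a tree component towards a vertex holding the cube of variety v assigned to the
-- component, and a component containing a cycle around that cycle; every other vertex picks the first
-- edge of a shortest walk to these anchors.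

open import Defs
open import Data.Bool using (true; false; if_then_else_; _∧_)
open import Data.Empty using (⊥-elim)
open import Data.Fin as Fin using (Fin; toℕ) renaming (zero to fzero; suc to fsuc)
import Data.Fin.Properties as Fin
open import Data.List using (List; []; _∷_; map; _++_; lookup)
open import Data.List.Relation.Unary.Any using (Any; any?; satisfied)
open import Data.Nat using (ℕ; zero; suc; _+_; _∸_; _≤_; _<_; z≤n; s≤s; s≤s⁻¹)
open import Data.Nat.GeneralisedArithmetic using (iterate)
open import Data.Nat.Induction using (<-rec)
import Data.Nat.Properties as ℕ
open import Data.Product using (Σ; ∃; _×_; _,_; proj₁; proj₂)
open import Data.Product.Properties using (≡-dec)
open import Data.Sum using (_⊎_; inj₁; inj₂; [_,_]′)
import Data.Vec as Vec
import Data.Vec.Properties as Vec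
open import Effect.Monad using (RawMonad)
open import Function using (_∘_; _⇔_; mk⇔; Equivalence)
open import Function.Definitions using (Injective)
open import Level using (0ℓ)
open import Relation.Binary using (DecidableEquality)
open import Relation.Binary.Construct.Closure.ReflexiveTransitive using (ε; _◅_; _◅◅_)
open import Relation.Binary.PropositionalEquality
open import Relation.Nullary using (Dec; yes; no; ¬_)
open import Relation.Nullary.Decidable
  using (map′; from-yes; _×-dec_; _⊎-dec_; _→-dec_; ¬?; ¬¬-excluded-middle; decidable-stable)
open import Relation.Nullary.Negation using (¬¬-Monad)
open import Relation.Unary using (Decidable)

open ≡-Reasoning
open RawMonad (¬¬-Monad {0ℓ}) using (_>>=_; pure; _<$>_)

private variable
  A B C : Set

-- Finite search

Exhaustible : Set → Set₁
Exhaustible A = ∀ {P : A → Set} → Decidable P → Dec (∀ x → P x)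

Searchable : Set → Set₁
Searchable A = ∀ {P : A → Set} → Decidable P → Dec (∃ P)

∀-sign? : Exhaustible Sign
∀-sign? P? = map′ (λ (p , n) → λ { pos → p ; neg → n }) (λ h → h pos , h neg)
                  (P? pos ×-dec P? neg)

∃-sign? : Searchable Sign
∃-sign? P? = map′ (λ { (inj₁ p) → pos , p ; (inj₂ n) → neg , n })
                  (λ { (pos , p) → inj₁ p ; (neg , n) → inj₂ n })
                  (P? pos ⊎-dec P? neg)

∀-axis? : Exhaustible Axis
∀-axis? P? = map′ (λ (x , y , z) → λ { X → x ; Y → y ; Z → z }) (λ h → h X , h Y , h Z)
                  (P? X ×-dec P? Y ×-dec P? Z)

∀-gen? : Exhaustible Gen
∀-gen? P? = map′ (λ (p , q) → λ { rz → p ; rx → q }) (λ h → h rz , h rx)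
                 (P? rz ×-dec P? rx)

∀-×? : Exhaustible A → Exhaustible B → Exhaustible (A × B)
∀-×? ∀A ∀B P? = map′ (λ h (a , b) → h a b) (λ h a b → h (a , b))
                     (∀A λ a → ∀B λ b → P? (a , b))

∃-×? : Searchable A → Searchable B → Searchable (A × B)
∃-×? ∃A ∃B P? = map′ (λ (a , b , p) → (a , b) , p) (λ ((a , b) , p) → a , b , p)
                     (∃A λ a → ∃B λ b → P? (a , b))

∃-vec? : ∀ {n} → Searchable A → Searchable (Vec.Vec A n)
∃-vec? {n = zero}  ∃A P? = map′ (Vec.[] ,_) (λ { (Vec.[] , p) → p }) (P? Vec.[])
∃-vec? {n = suc n} ∃A P? = map′ (λ (x , xs , p) → x Vec.∷ xs , p)
                                (λ { (x Vec.∷ xs , p) → x , xs , p })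
                                (∃A λ x → ∃-vec? ∃A λ xs → P? (x Vec.∷ xs))

∀-face? : Exhaustible Face
∀-face? = ∀-×? ∀-axis? ∀-sign?

∀-corner? : Exhaustible Corner
∀-corner? = ∀-×? ∀-sign? (∀-×? ∀-sign? ∀-sign?)

∃-corner? : Searchable Corner
∃-corner? = ∃-×? ∃-sign? (∃-×? ∃-sign? ∃-sign?)

_≟ᵃ_ : DecidableEquality Axis
X ≟ᵃ X = yes refl
X ≟ᵃ Y = no λ ()
X ≟ᵃ Z = no λ ()
Y ≟ᵃ X = no λ ()
Y ≟ᵃ Y = yes refl
Y ≟ᵃ Z = no λ ()
Z ≟ᵃ X = no λ ()
Z ≟ᵃ Y = no λ ()
Z ≟ᵃ Z = yes refl

_≟ˢ_ : DecidableEquality Sign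
pos ≟ˢ pos = yes refl
pos ≟ˢ neg = no λ ()
neg ≟ˢ pos = no λ ()
neg ≟ˢ neg = yes refl

_≟ᶠ_ : DecidableEquality Face
_≟ᶠ_ = ≡-dec _≟ᵃ_ _≟ˢ_

_≟ᶜ_ : DecidableEquality Corner
_≟ᶜ_ = ≡-dec _≟ˢ_ (≡-dec _≟ˢ_ _≟ˢ_)

cornerAt : Fin 8 → Corner
cornerAt = lookup ((pos , pos , pos) ∷ (pos , pos , neg) ∷ (pos , neg , pos) ∷ (pos , neg , neg) ∷
                   (neg , pos , pos) ∷ (neg , pos , neg) ∷ (neg , neg , pos) ∷ (neg , neg , neg) ∷ [])

opaque
  corner-enumerated : ∀ k → ∃ λ i → cornerAt i ≡ k
  corner-enumerated = from-yes (∀-corner? λ k → Fin.any? λ i → cornerAt i ≟ᶜ k)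

cornerIndex : Corner → Fin 8
cornerIndex k = proj₁ (corner-enumerated k)

cornerAt-cornerIndex : ∀ k → cornerAt (cornerIndex k) ≡ k
cornerAt-cornerIndex k = proj₂ (corner-enumerated k)

cornerIndex-injective : Injective _≡_ _≡_ cornerIndex
cornerIndex-injective {k} {k'} e =
  trans (sym (cornerAt-cornerIndex k)) (trans (cong cornerAt e) (cornerAt-cornerIndex k'))

faceAt : Fin 6 → Face
faceAt = lookup ((X , pos) ∷ (X , neg) ∷ (Y , pos) ∷ (Y , neg) ∷ (Z , pos) ∷ (Z , neg) ∷ [])

opaque
  faceAt-injective : Injective _≡_ _≡_ faceAt
  faceAt-injective {i} {j} =
    from-yes (Fin.all? λ i → Fin.all? λ j → (faceAt i ≟ᶠ faceAt j) →-dec (i Fin.≟ j)) i j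

-- Cyclic triples

_³ : Set → Set
A ³ = A × A × A

≡³-dec : DecidableEquality A → DecidableEquality (A ³)
≡³-dec _≟_ = ≡-dec _≟_ (≡-dec _≟_ _≟_)

map³ : (A → B) → A ³ → B ³
map³ f (a , b , c) = f a , f b , f c

map³-id : (t : A ³) → map³ (λ x → x) t ≡ t
map³-id (a , b , c) = refl

map³-∘ : ∀ (f : B → C) (g : A → B) t → map³ (f ∘ g) t ≡ map³ f (map³ g t)
map³-∘ f g (a , b , c) = refl

map³-cong : ∀ {f g : A → B} → (∀ x → f x ≡ g x) → ∀ t → map³ f t ≡ map³ g t
map³-cong f≗g (a , b , c) = cong₂ _,_ (f≗g a) (cong₂ _,_ (f≗g b) (f≗g c))

map³-injective : ∀ {f : A → B} → Injective _≡_ _≡_ f → Injective _≡_ _≡_ (map³ f)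
map³-injective f-injective {_ , _ , _} {_ , _ , _} e =
  cong₂ _,_ (f-injective (cong proj₁ e))
            (cong₂ _,_ (f-injective (cong (proj₁ ∘ proj₂) e)) (f-injective (cong (proj₂ ∘ proj₂) e)))

_‼_ : A ³ → Axis → A
(x , _ , _) ‼ X = x
(_ , y , _) ‼ Y = y
(_ , _ , z) ‼ Z = z

rotate : A ³ → A ³
rotate (a , b , c) = b , c , a

iterate-+ : ∀ (f : A → A) x m n → iterate f x (m + n) ≡ iterate f (iterate f x m) n
iterate-+ f x zero    n = refl
iterate-+ f x (suc m) n = iterate-+ f (f x) m n

map³-iterate-rotate : ∀ (f : A → B) t n → map³ f (iterate rotate t n) ≡ iterate rotate (map³ f t) n
map³-iterate-rotate f t           zero    = refl
map³-iterate-rotate f (a , b , c) (suc n) = map³-iterate-rotate f (b , c , a) n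

_≈_ : A ³ → A ³ → Set
t ≈ t' = ∃ λ n → iterate rotate t n ≡ t'

≈-trans : {t t' t'' : A ³} → t ≈ t' → t' ≈ t'' → t ≈ t''
≈-trans {t = t} (m , refl) (n , refl) = m + n , iterate-+ rotate t m n

≈-bounded : {t t' : A ³} → t ≈ t' → ∃ λ (i : Fin 3) → iterate rotate t (toℕ i) ≡ t'
≈-bounded (0 , e) = fzero , e
≈-bounded (1 , e) = fsuc fzero , e
≈-bounded (2 , e) = fsuc (fsuc fzero) , e
≈-bounded {t = _ , _ , _} (suc (suc (suc n)) , e) = ≈-bounded (n , e)

≈-sym : {t t' : A ³} → t ≈ t' → t' ≈ t
≈-sym {t = _ , _ , _} t≈t' with ≈-bounded t≈t'
... | fzero             , refl = 0 , refl
... | fsuc fzero        , refl = 2 , refl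
... | fsuc (fsuc fzero) , refl = 1 , refl

≈-dec : DecidableEquality A → (t t' : A ³) → Dec (t ≈ t')
≈-dec _≟_ t t' = map′ (λ (i , e) → toℕ i , e) ≈-bounded
                      (Fin.any? λ i → ≡³-dec _≟_ (iterate rotate t (toℕ i)) t')

map³-≈ : ∀ (f : A → B) {t t'} → t ≈ t' → map³ f t ≈ map³ f t'
map³-≈ f {t} (n , refl) = n , sym (map³-iterate-rotate f t n)

map³-≈⁻¹ : ∀ {f : A → B} {t t'} → Injective _≡_ _≡_ f → map³ f t ≈ map³ f t' → t ≈ t'
map³-≈⁻¹ {f = f} {t} f-injective (n , e) =
  n , map³-injective f-injective (trans (map³-iterate-rotate f t n) e)

Distinct : A ³ → Set
Distinct (a , b , c) = a ≢ b × b ≢ c × c ≢ a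

distinct? : DecidableEquality A → (t : A ³) → Dec (Distinct t)
distinct? _≟_ (a , b , c) = ¬? (a ≟ b) ×-dec ¬? (b ≟ c) ×-dec ¬? (c ≟ a)

Distinct-rotate : {t : A ³} → Distinct t → Distinct (rotate t)
Distinct-rotate {t = _ , _ , _} (a≢b , b≢c , c≢a) = b≢c , c≢a , a≢b

Distinct-map³ : ∀ {f : A → B} {t} → Injective _≡_ _≡_ f → Distinct t → Distinct (map³ f t)
Distinct-map³ {t = _ , _ , _} f-injective (a≢b , b≢c , c≢a) =
  a≢b ∘ f-injective , b≢c ∘ f-injective , c≢a ∘ f-injective

_≟ᵗ_ : DecidableEquality Triple
_≟ᵗ_ = ≡³-dec Fin._≟_

normalize-≈ : ∀ t → t ≈ normalize t
normalize-≈ (a , b , c) with (a <c b) ∧ (a <c c) | (b <c a) ∧ (b <c c)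
... | true  | _     = 0 , refl
... | false | true  = 1 , refl
... | false | false = 2 , refl

opaque
  normalize-rotate : ∀ t → Distinct t → normalize (rotate t) ≡ normalize t
  normalize-rotate (a , b , c) = from-yes (Fin.all? λ a → Fin.all? λ b → Fin.all? λ c →
    distinct? Fin._≟_ (a , b , c) →-dec (normalize (rotate (a , b , c)) ≟ᵗ normalize (a , b , c))) a b c

normalize-iterate-rotate : ∀ {t} n → Distinct t → normalize (iterate rotate t n) ≡ normalize t
normalize-iterate-rotate     zero    _        = refl
normalize-iterate-rotate {t} (suc n) distinct =
  trans (normalize-iterate-rotate n (Distinct-rotate distinct)) (normalize-rotate t distinct)

normalize≡⇔≈ : ∀ {t t'} → Distinct t → normalize t ≡ normalize t' ⇔ t ≈ t'
normalize≡⇔≈ {t} {t'} distinct = mk⇔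
  (λ e → ≈-trans (normalize-≈ t) (subst (_≈ t') (sym e) (≈-sym (normalize-≈ t'))))
  (λ { (n , refl) → sym (normalize-iterate-rotate n distinct) })

-- Corners and rotations

cornerFaces : Corner → Face ³
cornerFaces (sx , sy , sz) = if evenCorner (sx , sy , sz)
  then (X , sx) , (Z , sz) , (Y , sy)
  else (X , sx) , (Y , sy) , (Z , sz)

opaque
  cornerFaces-distinct : ∀ k → Distinct (cornerFaces k)
  cornerFaces-distinct = from-yes (∀-corner? λ k → distinct? _≟ᶠ_ (cornerFaces k))

cornerColors : Cube → Corner → Triple
cornerColors q k = map³ (color q) (cornerFaces k)

cornerTriple-cornerColors : ∀ q k → cornerTriple q k ≡ normalize (cornerColors q k)
cornerTriple-cornerColors q (sx , sy , sz) with evenCorner (sx , sy , sz)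
... | true  = refl
... | false = refl

cornerTriple≡⇔≈ : ∀ c k d u →
                  cornerTriple c k ≡ cornerTriple d u ⇔ cornerColors c k ≈ cornerColors d u
cornerTriple≡⇔≈ c k d u = mk⇔
  (λ e → Equivalence.to normalized (trans (sym c-k) (trans e d-u)))
  (λ c≈d → trans c-k (trans (Equivalence.from normalized c≈d) (sym d-u)))
  where
  c-k : cornerTriple c k ≡ normalize (cornerColors c k)
  c-k = cornerTriple-cornerColors c k

  d-u : cornerTriple d u ≡ normalize (cornerColors d u)
  d-u = cornerTriple-cornerColors d u

  normalized : normalize (cornerColors c k) ≡ normalize (cornerColors d u) ⇔
               cornerColors c k ≈ cornerColors d u
  normalized = normalize≡⇔≈ (Distinct-map³ (color-inj c) (cornerFaces-distinct k))

AgreeAt : Corner → Cube → Cube → Set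
AgreeAt u c d = ∀ a → color c (a , coord u a) ≡ color d (a , coord u a)

AgreeAt⇔cornerColors≡ : ∀ u c d → AgreeAt u c d ⇔ cornerColors c u ≡ cornerColors d u
AgreeAt⇔cornerColors≡ (sx , sy , sz) c d with evenCorner (sx , sy , sz)
... | true  = mk⇔ (λ h → cong₂ _,_ (h X) (cong₂ _,_ (h Z) (h Y)))
                  λ e → λ { X → cong proj₁ e
                          ; Y → cong (proj₂ ∘ proj₂) e
                          ; Z → cong (proj₁ ∘ proj₂) e }
... | false = mk⇔ (λ h → cong₂ _,_ (h X) (cong₂ _,_ (h Y) (h Z)))
                  λ e → λ { X → cong proj₁ e
                          ; Y → cong (proj₁ ∘ proj₂) e
                          ; Z → cong (proj₂ ∘ proj₂) e }

AgreeAt⇒cornerTriple≡ : ∀ u c d → AgreeAt u c d → cornerTriple c u ≡ cornerTriple d u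
AgreeAt⇒cornerTriple≡ u c d agree = begin
  cornerTriple c u              ≡⟨ cornerTriple-cornerColors c u ⟩
  normalize (cornerColors c u)  ≡⟨ cong normalize (Equivalence.to (AgreeAt⇔cornerColors≡ u c d) agree) ⟩
  normalize (cornerColors d u)  ≡⟨ sym (cornerTriple-cornerColors d u) ⟩
  cornerTriple d u              ∎

cornerStep : Gen → Corner → Corner
cornerStep rz (sx , sy , sz) = flip sy , sx , sz
cornerStep rx (sx , sy , sz) = sx , flip sz , sy

cornerAct : Rotation → Corner → Corner
cornerAct []      k = k
cornerAct (g ∷ r) k = cornerStep g (cornerAct r k)

opaque
  genAct-cornerFaces : ∀ g k → map³ (genAct g) (cornerFaces k) ≈ cornerFaces (cornerStep g k)
  genAct-cornerFaces = from-yes (∀-gen? λ g → ∀-corner? λ k →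
    ≈-dec _≟ᶠ_ (map³ (genAct g) (cornerFaces k)) (cornerFaces (cornerStep g k)))

  genAct-injective : ∀ g → Injective _≡_ _≡_ (genAct g)
  genAct-injective g {f} {f'} = from-yes (∀-gen? λ g → ∀-face? λ f → ∀-face? λ f' →
    (genAct g f ≟ᶠ genAct g f') →-dec (f ≟ᶠ f')) g f f'

  cornerStep-injective : ∀ g → Injective _≡_ _≡_ (cornerStep g)
  cornerStep-injective g {k} {k'} = from-yes (∀-gen? λ g → ∀-corner? λ k → ∀-corner? λ k' →
    (cornerStep g k ≟ᶜ cornerStep g k') →-dec (k ≟ᶜ k')) g k k'

  genAct-order-4 : ∀ g f → genAct g (genAct g (genAct g (genAct g f))) ≡ f
  genAct-order-4 = from-yes (∀-gen? λ g → ∀-face? λ f →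
    genAct g (genAct g (genAct g (genAct g f))) ≟ᶠ f)

act-cornerFaces : ∀ r k → map³ (act r) (cornerFaces k) ≈ cornerFaces (cornerAct r k)
act-cornerFaces []      k = 0 , map³-id (cornerFaces k)
act-cornerFaces (g ∷ r) k =
  subst (_≈ cornerFaces (cornerAct (g ∷ r) k)) (sym (map³-∘ (genAct g) (act r) (cornerFaces k)))
    (≈-trans (map³-≈ (genAct g) (act-cornerFaces r k)) (genAct-cornerFaces g (cornerAct r k)))

act-injective : ∀ r → Injective _≡_ _≡_ (act r)
act-injective []      e = e
act-injective (g ∷ r) e = act-injective r (genAct-injective g e)

cornerAct-injective : ∀ r → Injective _≡_ _≡_ (cornerAct r)
cornerAct-injective []      e = e
cornerAct-injective (g ∷ r) e = cornerAct-injective r (cornerStep-injective g e)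

inverse : Rotation → Rotation
inverse []      = []
inverse (g ∷ r) = inverse r ++ g ∷ g ∷ g ∷ []

act-++ : ∀ r s f → act (r ++ s) f ≡ act r (act s f)
act-++ []      s f = refl
act-++ (g ∷ r) s f = cong (genAct g) (act-++ r s f)

act-inverse : ∀ r f → act r (act (inverse r) f) ≡ f
act-inverse []      f = refl
act-inverse (g ∷ r) f = begin
  genAct g (act r (act (inverse r ++ g³) f))      ≡⟨ cong (genAct g ∘ act r) (act-++ (inverse r) g³ f) ⟩
  genAct g (act r (act (inverse r) (act g³ f)))   ≡⟨ cong (genAct g) (act-inverse r (act g³ f)) ⟩
  genAct g (act g³ f)                             ≡⟨ genAct-order-4 g f ⟩
  f                                               ∎
  where
  g³ : Rotation
  g³ = g ∷ g ∷ g ∷ []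

-- Every rotation of the cube is a word of length at most 5 in rz and rx.
wordsUpTo : ℕ → List Rotation
wordsUpTo zero    = [] ∷ []
wordsUpTo (suc n) = [] ∷ map (rz ∷_) (wordsUpTo n) ++ map (rx ∷_) (wordsUpTo n)

opaque
  rotations-transitive : ∀ k u (i : Fin 3) →
                         ∃ λ w → map³ (act w) (cornerFaces u) ≡ iterate rotate (cornerFaces k) (toℕ i)
  rotations-transitive k u i = satisfied (table k u i)
    where
    Onto : Corner → Corner → Fin 3 → Rotation → Set
    Onto k u i w = map³ (act w) (cornerFaces u) ≡ iterate rotate (cornerFaces k) (toℕ i)

    table : ∀ k u i → Any (Onto k u i) (wordsUpTo 5)
    table = from-yes (∀-corner? λ k → ∀-corner? λ u → Fin.all? λ (i : Fin 3) → any? (λ w →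
      ≡³-dec _≟ᶠ_ (map³ (act w) (cornerFaces u)) (iterate rotate (cornerFaces k) (toℕ i))) (wordsUpTo 5))

rotateCube : Cube → Rotation → Cube
rotateCube c w = cube (color c ∘ act w) (λ e → act-injective w (color-inj c e))

SameVariety-sym : ∀ {c d} → SameVariety c d → SameVariety d c
SameVariety-sym {c} {d} (r , d≗c∘r) =
  inverse r , λ f → sym (trans (d≗c∘r (act (inverse r) f)) (cong (color c) (act-inverse r f)))

SameVariety-cornerTriple : ∀ {c d} (c~d : SameVariety c d) k →
                           cornerTriple d k ≡ cornerTriple c (cornerAct (proj₁ c~d) k)
SameVariety-cornerTriple {c} {d} (r , d≗c∘r) k = Equivalence.from (cornerTriple≡⇔≈ d k c (cornerAct r k))
  (subst (_≈ cornerColors c (cornerAct r k)) (sym rotated) (map³-≈ (color c) (act-cornerFaces r k)))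
  where
  rotated : cornerColors d k ≡ map³ (color c) (map³ (act r) (cornerFaces k))
  rotated = trans (map³-cong d≗c∘r (cornerFaces k)) (map³-∘ (color c) (act r) (cornerFaces k))

InT-SameVariety : ∀ {c d t} → SameVariety c d → InT t d → InT t c
InT-SameVariety {c} {d} c~d (k , e) =
  cornerAct (proj₁ c~d) k , trans (sym (SameVariety-cornerTriple {c} {d} c~d k)) e

SameVariety⇒InT : ∀ {c v} → SameVariety c v → ∀ u → InT (cornerTriple v u) c
SameVariety⇒InT {c} {v} c~v u = InT-SameVariety {c} {v} c~v (u , refl)

aligning-rotation : ∀ c v u → InT (cornerTriple v u) c → ∃ λ w → AgreeAt u (rotateCube c w) v
aligning-rotation c v u (k , e) = aligned (≈-bounded (Equivalence.to (cornerTriple≡⇔≈ c k v u) e))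
  where
  aligned : (∃ λ (i : Fin 3) → iterate rotate (cornerColors c k) (toℕ i) ≡ cornerColors v u) →
            ∃ λ w → AgreeAt u (rotateCube c w) v
  aligned (i , shifted) with rotations-transitive k u i
  ... | w , turned = w , Equivalence.from (AgreeAt⇔cornerColors≡ u (rotateCube c w) v) (begin
    map³ (color c ∘ act w) (cornerFaces u)
      ≡⟨ map³-∘ (color c) (act w) (cornerFaces u) ⟩
    map³ (color c) (map³ (act w) (cornerFaces u))
      ≡⟨ cong (map³ (color c)) turned ⟩
    map³ (color c) (iterate rotate (cornerFaces k) (toℕ i))
      ≡⟨ map³-iterate-rotate (color c) (cornerFaces k) (toℕ i) ⟩
    iterate rotate (cornerColors c k) (toℕ i)
      ≡⟨ shifted ⟩
    cornerColors v u
      ∎)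

-- Assembling a solid

record Cover (I : Instance) (v : Cube) : Set where
  field
    cube-at   : Corner → Idx I
    injective : Injective _≡_ _≡_ cube-at
    covers    : ∀ u → InT (cornerTriple v u) (lookup I (cube-at u))

Cover⇒Composable : ∀ I v → Cover I v → Composable I v
Cover⇒Composable I v record { cube-at = a ; injective = a-injective ; covers = covers } =
  a , placed , v , a-injective , (λ p → proj₁ (turn p) , λ f → refl) , exposed , ([] , λ f → refl)
  where
  turn : ∀ p → ∃ λ w → AgreeAt p (rotateCube (lookup I (a p)) w) v
  turn p = aligning-rotation (lookup I (a p)) v p (covers p)

  placed : Position → Cube
  placed p = rotateCube (lookup I (a p)) (proj₁ (turn p))

  exposed : ∀ p f → Exposed p f → color (placed p) f ≡ color v f
  exposed p (x , _) refl = proj₂ (turn p) x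

Composable⇒Cover : ∀ I v → Composable I v → Cover I v
Composable⇒Cover I v (idx , placed , S , idx-injective , rotated , exposed , S~v) = record
  { cube-at   = idx ∘ cornerAct r
  ; injective = λ e → cornerAct-injective r (idx-injective e)
  ; covers    = λ u → InT-SameVariety {lookup I (idx (cornerAct r u))} {placed (cornerAct r u)}
                        (rotated (cornerAct r u)) (cornerAct r u , shown u)
  }
  where
  r : Rotation
  r = proj₁ S~v

  shown : ∀ u → cornerTriple (placed (cornerAct r u)) (cornerAct r u) ≡ cornerTriple v u
  shown u = trans (AgreeAt⇒cornerTriple≡ p (placed p) S λ x → exposed p (x , coord p x) refl)
                  (sym (SameVariety-cornerTriple {S} {v} S~v u))
    where
    p : Position
    p = cornerAct r u

-- Corner triples shared by two cubes

color-surjective : ∀ (q : Cube) y → ∃ λ f → color q f ≡ y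
color-surjective q y with Fin.any? (λ i → color q (faceAt i) Fin.≟ y)
... | yes (i , e) = faceAt i , e
... | no missed   = ⊥-elim (Fin.<⇒notInjective ℕ.≤-refl λ {i} {j} → squeeze {i} {j})
  where
  avoids : ∀ i → y ≢ color q (faceAt i)
  avoids i e = missed (i , sym e)

  squeeze : Injective _≡_ _≡_ (λ i → Fin.punchOut (avoids i))
  squeeze {i} {j} e = faceAt-injective (color-inj q (Fin.punchOut-injective (avoids i) (avoids j) e))

relabelling : ∀ d v → ∃ λ (π : Face → Face) → ∀ f → color d f ≡ color v (π f)
relabelling d v =
  (λ f → proj₁ (color-surjective v (color d f))) , λ f → sym (proj₂ (color-surjective v (color d f)))

Shares : (Face → Face) → Corner → Set
Shares π u = ∃ λ k → map³ π (cornerFaces k) ≈ cornerFaces u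

shares? : ∀ π u → Dec (Shares π u)
shares? π u = ∃-corner? λ k → ≈-dec _≟ᶠ_ (map³ π (cornerFaces k)) (cornerFaces u)

Shares-cong : ∀ {π π'} → (∀ f → π f ≡ π' f) → ∀ {u} → Shares π u → Shares π' u
Shares-cong π≗π' {u} (k , s) = k , subst (_≈ cornerFaces u) (map³-cong π≗π' (cornerFaces k)) s

InT⇔Shares : ∀ d v π → (∀ f → color d f ≡ color v (π f)) →
             ∀ u → InT (cornerTriple v u) d ⇔ Shares π u
InT⇔Shares d v π relabel u = mk⇔
  (λ (k , e) → k , map³-≈⁻¹ (color-inj v) (subst (_≈ cornerColors v u) (relabelled k)
                                             (Equivalence.to (cornerTriple≡⇔≈ d k v u) e)))
  (λ (k , s) → k , Equivalence.from (cornerTriple≡⇔≈ d k v u)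
                     (subst (_≈ cornerColors v u) (sym (relabelled k)) (map³-≈ (color v) s)))
  where
  relabelled : ∀ k → cornerColors d k ≡ map³ (color v) (map³ π (cornerFaces k))
  relabelled k = trans (map³-cong relabel (cornerFaces k)) (map³-∘ (color v) π (cornerFaces k))

oppositeFaces : Corner → Face ³
oppositeFaces u = (X , flip (coord u X)) , (Y , flip (coord u Y)) , (Z , flip (coord u Z))

fixAt : Corner → Face ³ → Face → Face
fixAt u t (a , s) with coord u a ≟ˢ s
... | yes _ = a , s
... | no  _ = t ‼ a

other-sign : ∀ {s s'} → s ≢ s' → s' ≡ flip s
other-sign {pos} {pos} s≢s' = ⊥-elim (s≢s' refl)
other-sign {pos} {neg} _    = refl
other-sign {neg} {pos} _    = refl
other-sign {neg} {neg} s≢s' = ⊥-elim (s≢s' refl)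

fixAt-unique : ∀ {π : Face → Face} u → (∀ a → π (a , coord u a) ≡ (a , coord u a)) →
               ∀ f → π f ≡ fixAt u (map³ π (oppositeFaces u)) f
fixAt-unique {π} u fixes (a , s) with coord u a ≟ˢ s
... | yes refl = fixes a
... | no  u≢s  = trans (cong (λ s' → π (a , s')) (other-sign u≢s)) (opposite a)
  where
  opposite : ∀ a → π (a , flip (coord u a)) ≡ map³ π (oppositeFaces u) ‼ a
  opposite X = refl
  opposite Y = refl
  opposite Z = refl

ExactlyOneOther : (Corner → Set) → Corner → Set
ExactlyOneOther P u = ∃ λ u' → u' ≢ u × P u' × ∀ w → P w → w ≡ u ⊎ w ≡ u'

opaque
  corner-fixing-permutations : ∀ u t → (∀ f f' → fixAt u t f ≡ fixAt u t f' → f ≡ f') →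
                               (∀ f → fixAt u t f ≡ f) ⊎ ExactlyOneOther (Shares (fixAt u t)) u
  corner-fixing-permutations = from-yes (∀-corner? λ u → ∀-×? ∀-face? (∀-×? ∀-face? ∀-face?) λ t →
    (∀-face? λ f → ∀-face? λ f' → (fixAt u t f ≟ᶠ fixAt u t f') →-dec (f ≟ᶠ f')) →-dec
    ((∀-face? λ f → fixAt u t f ≟ᶠ f) ⊎-dec
     (∃-corner? λ u' → ¬? (u' ≟ᶜ u) ×-dec shares? (fixAt u t) u' ×-dec
        ∀-corner? λ w → shares? (fixAt u t) w →-dec ((w ≟ᶜ u) ⊎-dec (w ≟ᶜ u')))))

  third-corner : ∀ (u u' : Corner) → ∃ λ w → w ≢ u × w ≢ u'
  third-corner = from-yes (∀-corner? λ u → ∀-corner? λ u' → ∃-corner? λ w →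
    ¬? (w ≟ᶜ u) ×-dec ¬? (w ≟ᶜ u'))

-- Relative to v, a cube agreeing with v at u is v composed with a face permutation fixing the three
-- faces at u, and such a permutation is determined by its values on the three opposite faces.
aligned-shared-corners : ∀ d v u → AgreeAt u d v →
  (∀ f → color d f ≡ color v f) ⊎ ExactlyOneOther (λ w → InT (cornerTriple v w) d) u
aligned-shared-corners d v u agree =
  classify (corner-fixing-permutations u (map³ π (oppositeFaces u)) σ-injective)
  where
  π : Face → Face
  π = proj₁ (relabelling d v)

  relabel : ∀ f → color d f ≡ color v (π f)
  relabel = proj₂ (relabelling d v)

  σ : Face → Face
  σ = fixAt u (map³ π (oppositeFaces u))

  π≗σ : ∀ f → π f ≡ σ f
  π≗σ = fixAt-unique u λ a → color-inj v (trans (sym (relabel (a , coord u a))) (agree a))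

  σ-injective : ∀ f f' → σ f ≡ σ f' → f ≡ f'
  σ-injective f f' e = color-inj d (begin
    color d f      ≡⟨ relabel f ⟩
    color v (π f)  ≡⟨ cong (color v) (trans (π≗σ f) (trans e (sym (π≗σ f')))) ⟩
    color v (π f') ≡⟨ sym (relabel f') ⟩
    color d f'     ∎)

  InT⇔Shares-σ : ∀ w → InT (cornerTriple v w) d ⇔ Shares σ w
  InT⇔Shares-σ w = mk⇔ (Shares-cong π≗σ ∘ Equivalence.to (InT⇔Shares d v π relabel w))
                        (Equivalence.from (InT⇔Shares d v π relabel w) ∘ Shares-cong (sym ∘ π≗σ))

  classify : (∀ f → σ f ≡ f) ⊎ ExactlyOneOther (Shares σ) u →
             (∀ f → color d f ≡ color v f) ⊎ ExactlyOneOther (λ w → InT (cornerTriple v w) d) u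
  classify (inj₁ identity) = inj₁ λ f → trans (relabel f) (cong (color v) (trans (π≗σ f) (identity f)))
  classify (inj₂ (u' , u'≢u , shares' , only)) = inj₂
    (u' , u'≢u , Equivalence.from (InT⇔Shares-σ u') shares' ,
     λ w i → only w (Equivalence.to (InT⇔Shares-σ w) i))

opaque
  shared-corners : ∀ c v u → InT (cornerTriple v u) c →
                   SameVariety c v ⊎ ExactlyOneOther (λ w → InT (cornerTriple v w) c) u
  shared-corners c v u shared = transfer (aligning-rotation c v u shared)
    where
    transfer : (∃ λ w → AgreeAt u (rotateCube c w) v) →
               SameVariety c v ⊎ ExactlyOneOther (λ w → InT (cornerTriple v w) c) u
    transfer (w , agree) =
      [ (λ same → inj₁ (w , sym ∘ same))
      , (λ (u' , u'≢u , shared' , only) → inj₂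
          (u' , u'≢u , InT-SameVariety {c} {d} c~d shared' ,
           λ x i → only x (InT-SameVariety {d} {c} (SameVariety-sym {c} {d} c~d) i)))
      ]′ (aligned-shared-corners d v u agree)
      where
      d : Cube
      d = rotateCube c w

      c~d : SameVariety c d
      c~d = w , λ f → refl

-- Sequences in a finite type

record Lasso (w : ℕ → A) : Set where
  field
    stem loop : ℕ
    simple    : ∀ {i j} → i ≤ loop → j ≤ loop → w (i + stem) ≡ w (j + stem) → i ≡ j
    closes    : w (suc loop + stem) ≡ w stem

module _ {n} {index : A → Fin n} (index-injective : Injective _≡_ _≡_ index) where

  private
    DistinctUpTo : (ℕ → A) → ℕ → Set
    DistinctUpTo w t = ∀ {i j} → i ≤ t → j ≤ t → w i ≡ w j → i ≡ j

    lasso-or-distinct : ∀ (w : ℕ → A) t → Lasso w ⊎ DistinctUpTo w t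
    lasso-or-distinct w zero = inj₂ λ { z≤n z≤n _ → refl }
    lasso-or-distinct w (suc t) with lasso-or-distinct w t
    ... | inj₁ l = inj₁ l
    ... | inj₂ distinct with Fin.any? (λ (i : Fin (suc t)) → index (w (toℕ i)) Fin.≟ index (w (suc t)))
    ...   | yes (i , e) = inj₁ record
      { stem   = toℕ i
      ; loop   = t ∸ toℕ i
      ; simple = λ i' j' → ℕ.+-cancelʳ-≡ (toℕ i) _ _ ∘ distinct (within i') (within j')
      ; closes = subst (λ q → w q ≡ w (toℕ i)) (sym (cong suc (ℕ.m∸n+n≡m i≤t)))
                       (sym (index-injective e))
      }
      where
      i≤t : toℕ i ≤ t
      i≤t = Fin.toℕ≤pred[n] i

      within : ∀ {j} → j ≤ t ∸ toℕ i → j + toℕ i ≤ t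
      within {j} j≤ = subst (j + toℕ i ≤_) (ℕ.m∸n+n≡m i≤t) (ℕ.+-monoˡ-≤ (toℕ i) j≤)
    ...   | no fresh = inj₂ extended
      where
      new : ∀ {i} → i < suc t → w i ≢ w (suc t)
      new i< e = fresh (Fin.fromℕ< i< , cong index (trans (cong w (Fin.toℕ-fromℕ< i<)) e))

      extended : DistinctUpTo w (suc t)
      extended i≤ j≤ e with ℕ.m≤n⇒m<n∨m≡n i≤ | ℕ.m≤n⇒m<n∨m≡n j≤
      ... | inj₁ i<   | inj₁ j<   = distinct (s≤s⁻¹ i<) (s≤s⁻¹ j<) e
      ... | inj₁ i<   | inj₂ refl = ⊥-elim (new i< e)
      ... | inj₂ refl | inj₁ j<   = ⊥-elim (new j< (sym e))
      ... | inj₂ refl | inj₂ refl = refl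

  opaque
    lasso : ∀ (w : ℕ → A) → Lasso w
    lasso w with lasso-or-distinct w n
    ... | inj₁ l = l
    ... | inj₂ distinct with Fin.pigeonhole (ℕ.n<1+n n) (λ (i : Fin (suc n)) → index (w (toℕ i)))
    ...   | i , j , i<j , e =
      ⊥-elim (ℕ.<-irrefl (distinct (Fin.toℕ≤pred[n] i) (Fin.toℕ≤pred[n] j) (index-injective e)) i<j)

-- Double negation

DoubleNegationShift : Set → Set₁
DoubleNegationShift A = ∀ {P : A → Set} → (∀ x → ¬ ¬ P x) → ¬ ¬ (∀ x → P x)

dns-sign : DoubleNegationShift Sign
dns-sign h = do
  p ← h pos
  n ← h neg
  pure λ { pos → p ; neg → n }

dns-× : DoubleNegationShift A → DoubleNegationShift B → DoubleNegationShift (A × B)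
dns-× dns-A dns-B h = (λ g (a , b) → g a b) <$> dns-A λ a → dns-B λ b → h (a , b)

dns-corner : DoubleNegationShift Corner
dns-corner = dns-× dns-sign (dns-× dns-sign dns-sign)

¬¬-least : ∀ {P : ℕ → Set} {n} → P n → ¬ ¬ (∃ λ m → P m × ∀ {k} → k < m → ¬ P k)
¬¬-least {P} {n} = <-rec (λ n → P n → ¬ ¬ Least) search n
  where
  Least : Set
  Least = ∃ λ m → P m × ∀ {k} → k < m → ¬ P k

  search : ∀ n → (∀ {m} → m < n → P m → ¬ ¬ Least) → P n → ¬ ¬ Least
  search n smaller pn = ¬¬-excluded-middle {A = ∃ λ m → m < n × P m} >>= λ where
    (yes (m , m<n , pm)) → smaller m<n pm
    (no none)            → pure (n , pn , λ {k} k<n pk → none (k , k<n , pk))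

-- The graph G_v

module Graph (I : Instance) (v : Cube) where

  Special : Idx I → Set
  Special i = SameVariety (lookup I i) v

  Joins⇒InT : ∀ {i k k'} → Joins I v i k k' → InT (cornerTriple v k) (lookup I i)
  Joins⇒InT (_ , _ , shared , _) = shared

  Joins⇒≢ : ∀ {i k k'} → Joins I v i k k' → k ≢ k'
  Joins⇒≢ (_ , k≢k' , _) = k≢k'

  Joins-sym : ∀ {i k k'} → Joins I v i k k' → Joins I v i k' k
  Joins-sym (compatible , k≢k' , shared , shared') = compatible , k≢k' ∘ sym , shared' , shared

  Joins⇒¬Special : ∀ {i k k'} → Joins I v i k k' → ¬ Special i
  Joins⇒¬Special {i} ((v≁c , _) , _) c~v = v≁c (SameVariety-sym {lookup I i} {v} c~v)

  special-or-edge : ∀ {i u} → InT (cornerTriple v u) (lookup I i) → Special i ⊎ ∃ (Joins I v i u)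
  special-or-edge {i} {u} shared with shared-corners (lookup I i) v u shared
  ... | inj₁ c~v = inj₁ c~v
  ... | inj₂ (u' , u'≢u , shared' , only) =
    inj₂ (u' , (v≁c , cornerTriple v u , (u , refl) , shared) , u'≢u ∘ sym , shared , shared')
    where
    v≁c : ¬ SameVariety v (lookup I i)
    v≁c v~c with third-corner u u'
    ... | w , w≢u , w≢u' =
      [ w≢u , w≢u' ]′ (only w (SameVariety⇒InT {lookup I i} {v} (SameVariety-sym {v} {lookup I i} v~c) w))

  Joins-endpoint : ∀ {i k k' w} → Joins I v i k k' → InT (cornerTriple v w) (lookup I i) →
                   w ≡ k ⊎ w ≡ k'
  Joins-endpoint {i} {k} {k'} {w} J@(_ , k≢k' , shared , shared') sw
    with shared-corners (lookup I i) v k shared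
  ... | inj₁ c~v = ⊥-elim (Joins⇒¬Special J c~v)
  ... | inj₂ (_ , _ , _ , only) with only k' shared'
  ...   | inj₁ k'≡k = ⊥-elim (k≢k' (sym k'≡k))
  ...   | inj₂ refl = only w sw

  Joins-endpoints : ∀ {i k k' x x'} → Joins I v i k k' → Joins I v i x x' →
                    (x ≡ k × x' ≡ k') ⊎ (x ≡ k' × x' ≡ k)
  Joins-endpoints {x = x} {x'} J (_ , x≢x' , sx , sx')
    with Joins-endpoint {w = x} J sx | Joins-endpoint {w = x'} J sx'
  ... | inj₁ refl | inj₁ refl = ⊥-elim (x≢x' refl)
  ... | inj₁ refl | inj₂ refl = inj₁ (refl , refl)
  ... | inj₂ refl | inj₁ refl = inj₂ (refl , refl)
  ... | inj₂ refl | inj₂ refl = ⊥-elim (x≢x' refl)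

  Joins-Conn : ∀ {i k k' x x'} → Joins I v i k k' → Joins I v i x x' → Conn I v k x
  Joins-Conn {i} J J' with Joins-endpoints J J'
  ... | inj₁ (refl , _) = ε
  ... | inj₂ (refl , _) = (i , J) ◅ ε

  Conn-sym : ∀ {x y} → Conn I v x y → Conn I v y x
  Conn-sym ε              = ε
  Conn-sym ((i , J) ◅ xs) = Conn-sym xs ◅◅ ((i , Joins-sym J) ◅ ε)

  cycle-edge : (C : Cycle I v) → ∀ j → ∃ λ j' → Joins I v (Cycle.es C j) (Cycle.vs C j) (Cycle.vs C j')
  cycle-edge C j with toℕ j ℕ.≟ Cycle.m C
  ... | yes j≡m = fzero , subst (λ j → Joins I v (es j) (vs j) (vs fzero))
                                (Fin.toℕ-injective (trans (Fin.toℕ-fromℕ m) (sym j≡m))) close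
    where open Cycle C
  ... | no  j≢m = fsuc (Fin.lower₁ j m≢j) ,
                  subst (λ j' → Joins I v (es j') (vs j') (vs (fsuc (Fin.lower₁ j m≢j))))
                        (Fin.inject₁-lower₁ j m≢j) (step (Fin.lower₁ j m≢j))
    where
    open Cycle C
    m≢j : m ≢ toℕ j
    m≢j = j≢m ∘ sym

  module FromCover (cover : Cover I v) where
    open Cover cover renaming (cube-at to a; injective to a-injective)

    Move : Corner → Set
    Move u = Special (a u) ⊎ ∃ (Joins I v (a u) u)

    target : ∀ {u} → Move u → Corner
    target {u} (inj₁ _)       = u
    target     (inj₂ (u' , _)) = u'

    opaque
      move : ∀ u → Move u
      move u = special-or-edge {a u} {u} (covers u)

    next : Corner → Corner
    next u = target (move u)

    orbit : Corner → ℕ → Corner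
    orbit k zero    = k
    orbit k (suc n) = next (orbit k n)

    step : ∀ {u} (m : Move u) → Special (a u) ⊎ Joins I v (a u) u (target m)
    step (inj₁ special) = inj₁ special
    step (inj₂ (_ , J)) = inj₂ J

    step-Conn : ∀ {u} (m : Move u) → Conn I v u (target m)
    step-Conn     (inj₁ _)       = ε
    step-Conn {u} (inj₂ (_ , J)) = (a u , J) ◅ ε

    orbit-Conn : ∀ k n → Conn I v k (orbit k n)
    orbit-Conn k zero    = ε
    orbit-Conn k (suc n) = orbit-Conn k n ◅◅ step-Conn (move (orbit k n))

    Edges : Corner → ℕ → Set
    Edges k n = ∀ j → j < n → Joins I v (a (orbit k j)) (orbit k j) (orbit k (suc j))

    special-or-edges : ∀ k n → (∃ λ j → Special (a (orbit k j))) ⊎ Edges k n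
    special-or-edges k zero = inj₂ λ _ ()
    special-or-edges k (suc n) with special-or-edges k n | step (move (orbit k n))
    ... | inj₁ found | _            = inj₁ found
    ... | inj₂ _     | inj₁ special = inj₁ (n , special)
    ... | inj₂ edges | inj₂ J       =
      inj₂ λ j j<1+n → [ edges j , (λ { refl → J }) ]′ (ℕ.m≤n⇒m<n∨m≡n (s≤s⁻¹ j<1+n))

    lasso-cycle : ∀ k (l : Lasso (orbit k)) → Edges k (suc (Lasso.loop l) + Lasso.stem l) →
                  Σ (Cycle I v) λ C → Cycle.vs C fzero ≡ orbit k (Lasso.stem l)
    lasso-cycle k l edges = record
      { m      = loop
      ; m≥1    = ℕ.n≢0⇒n>0 loop≢0
      ; vs     = vs
      ; es     = a ∘ vs
      ; vs-inj = vs-injective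
      ; es-inj = λ e → vs-injective (a-injective e)
      ; step   = λ j → subst (λ q → Edge q (orbit k (suc (toℕ j) + stem))) (sym (Fin.toℕ-inject₁ j))
                             (edge (toℕ j) (ℕ.<⇒≤ (Fin.toℕ<n j)))
      ; close  = subst (λ q → Edge q (orbit k stem)) (sym (Fin.toℕ-fromℕ loop))
                       (subst (Edge loop) closes (edge loop ℕ.≤-refl))
      } , refl
      where
      open Lasso l

      vs : Fin (suc loop) → Corner
      vs i = orbit k (toℕ i + stem)

      vs-injective : Injective _≡_ _≡_ vs
      vs-injective {i} {j} e = Fin.toℕ-injective (simple (Fin.toℕ≤pred[n] i) (Fin.toℕ≤pred[n] j) e)

      Edge : ℕ → Corner → Set
      Edge j = Joins I v (a (orbit k (j + stem))) (orbit k (j + stem))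

      edge : ∀ j → j ≤ loop → Edge j (orbit k (suc j + stem))
      edge j j≤loop = edges (j + stem) (s≤s (ℕ.+-monoˡ-≤ stem j≤loop))

      loop≢0 : loop ≢ 0
      loop≢0 refl = Joins⇒≢ (edge 0 z≤n) (sym closes)

    special-reachable : ∀ k → InTreeComponent I v k → ∃ λ j → Special (a (orbit k j))
    special-reachable k tree with lasso cornerIndex-injective (orbit k)
    ... | l with special-or-edges k (suc (Lasso.loop l) + Lasso.stem l)
    ...   | inj₁ found = found
    ...   | inj₂ edges with lasso-cycle k l edges
    ...     | C , start = ⊥-elim (tree (C , subst (Conn I v k) (sym start) (orbit-Conn k (Lasso.stem l))))

    fit : TreeComponentsFit I v
    fit = (λ k t → a (reached k t)) , (λ k t → proj₂ (special-reachable k t)) , coherent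
      where
      reached : ∀ k → InTreeComponent I v k → Corner
      reached k t = orbit k (proj₁ (special-reachable k t))

      coherent : ∀ k t k' t' → a (reached k t) ≡ a (reached k' t') → Conn I v k k'
      coherent k t k' t' e = orbit-Conn k (proj₁ (special-reachable k t)) ◅◅
        subst (λ z → Conn I v z k') (sym (a-injective e))
              (Conn-sym (orbit-Conn k' (proj₁ (special-reachable k' t'))))

  data Walk : Corner → Corner → ℕ → Set where
    []  : ∀ {x} → Walk x x 0
    _∷_ : ∀ {x y z n} → Adj I v x y → Walk y z n → Walk x z (suc n)

  walk-of : ∀ {x z} → Conn I v x z → ∃ (Walk x z)
  walk-of ε        = 0 , []
  walk-of (e ◅ xs) = suc (proj₁ (walk-of xs)) , e ∷ proj₂ (walk-of xs)

  ReachesCycle : Corner → Set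
  ReachesCycle r = Σ (Cycle I v) λ C → Conn I v r (Cycle.vs C fzero)

  data Anchoring (r : Corner) : Set where
    tree  : InTreeComponent I v r → Anchoring r
    cycle : (C : Cycle I v) → Conn I v r (Cycle.vs C fzero) → Anchoring r

  module FromFit (cube-of : (k : Corner) → InTreeComponent I v k → Idx I)
                 (cube-of-special : ∀ k t → Special (cube-of k t))
                 (cube-of-coherent : ∀ k t k' t' → cube-of k t ≡ cube-of k' t' → Conn I v k k') where

    data OnAnchor {r : Corner} : Anchoring r → Corner → Set where
      root     : ∀ {t} → OnAnchor (tree t) r
      on-cycle : ∀ {C c} j → OnAnchor (cycle C c) (Cycle.vs C j)

    anchorCube : ∀ {r} {a : Anchoring r} {z} → OnAnchor a z → Idx I
    anchorCube {r} (root {t})       = cube-of r t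
    anchorCube (on-cycle {C = C} j) = Cycle.es C j

    anchorCube-covers : ∀ {r} {a : Anchoring r} {z} (p : OnAnchor a z) →
                        InT (cornerTriple v z) (lookup I (anchorCube p))
    anchorCube-covers {r} (root {t}) =
      SameVariety⇒InT {lookup I (cube-of r t)} {v} (cube-of-special r t) r
    anchorCube-covers (on-cycle {C = C} j) = Joins⇒InT (proj₂ (cycle-edge C j))

    anchorCube-injective : ∀ {r} {a : Anchoring r} {z z'} (p : OnAnchor a z) (p' : OnAnchor a z') →
                           anchorCube p ≡ anchorCube p' → z ≡ z'
    anchorCube-injective root                 root          _ = refl
    anchorCube-injective (on-cycle {C = C} j) (on-cycle j') e = cong (Cycle.vs C) (Cycle.es-inj C e)

    anchorCube-Conn : ∀ {r r'} {a : Anchoring r} {a' : Anchoring r'} {z z'}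
                      (p : OnAnchor a z) (p' : OnAnchor a' z') → anchorCube p ≡ anchorCube p' → Conn I v z z'
    anchorCube-Conn {r} {r'} (root {t}) (root {t'}) e = cube-of-coherent r t r' t' e
    anchorCube-Conn {r} (root {t}) (on-cycle {C = C} j) e =
      ⊥-elim (Joins⇒¬Special (proj₂ (cycle-edge C j)) (subst Special e (cube-of-special r t)))
    anchorCube-Conn {r' = r'} (on-cycle {C = C} j) (root {t}) e =
      ⊥-elim (Joins⇒¬Special (proj₂ (cycle-edge C j)) (subst Special (sym e) (cube-of-special r' t)))
    anchorCube-Conn (on-cycle {C = C} j) (on-cycle {C = C'} j') e with cycle-edge C' j'
    ... | j'' , J' = Joins-Conn (proj₂ (cycle-edge C j))
                                (subst (λ i → Joins I v i (Cycle.vs C' j') (Cycle.vs C' j'')) (sym e) J')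

    anchorCube-endpoint : ∀ {r} {a : Anchoring r} {z y y'} (p : OnAnchor a z) →
                          Joins I v (anchorCube p) y y' →
                          OnAnchor a y × Conn I v z y
    anchorCube-endpoint {r} (root {t}) J = ⊥-elim (Joins⇒¬Special J (cube-of-special r t))
    anchorCube-endpoint (on-cycle {C = C} j) J with cycle-edge C j
    ... | j' , J₀ with Joins-endpoints J₀ J
    ...   | inj₁ (refl , _) = on-cycle j , ε
    ...   | inj₂ (refl , _) = on-cycle j' , (Cycle.es C j , J₀) ◅ ε

    some-anchor : ∀ {r} (a : Anchoring r) → ∃ λ z → OnAnchor a z × Conn I v r z
    some-anchor (tree t)    = _ , root , ε
    some-anchor (cycle C c) = _ , on-cycle fzero , c

    record Components : Set where
      field
        rep        : Corner → Corner
        rep-Conn   : ∀ x → Conn I v x (rep x)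
        rep-unique : ∀ {x y} → Conn I v x y → rep x ≡ rep y
        anchoring  : ∀ r → Anchoring r

    rank : Corner → ℕ
    rank = toℕ ∘ cornerIndex

    Least : Corner → Corner → Set
    Least x r = Conn I v x r × ∀ y → Conn I v x y → rank r ≤ rank y

    ¬¬least : ∀ x → ¬ ¬ ∃ (Least x)
    ¬¬least x = do
      (_ , (r , x~r , refl) , minimal) ←
        ¬¬-least {P = λ m → ∃ λ y → Conn I v x y × rank y ≡ m} (x , ε , refl)
      pure (r , x~r , λ y x~y → ℕ.≮⇒≥ λ y<r → minimal y<r (y , x~y , refl))

    Least-unique : ∀ {x y r r'} → Conn I v x y → Least x r → Least y r' → r ≡ r'
    Least-unique x~y (x~r , r-least) (y~r' , r'-least) = cornerIndex-injective (Fin.toℕ-injective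
      (ℕ.≤-antisym (r-least _ (x~y ◅◅ y~r')) (r'-least _ (Conn-sym x~y ◅◅ x~r))))

    ¬¬components : ¬ ¬ Components
    ¬¬components = do
      reps    ← dns-corner ¬¬least
      cycles? ← dns-corner λ r → ¬¬-excluded-middle {A = ReachesCycle r}
      pure record
        { rep        = λ x → proj₁ (reps x)
        ; rep-Conn   = λ x → proj₁ (proj₂ (reps x))
        ; rep-unique = λ {x} {y} x~y → Least-unique x~y (proj₂ (reps x)) (proj₂ (reps y))
        ; anchoring  = λ r → anchoring-of (cycles? r)
        }
      where
      anchoring-of : ∀ {r} → Dec (ReachesCycle r) → Anchoring r
      anchoring-of (yes (C , c)) = cycle C c
      anchoring-of (no acyclic)  = tree acyclic

    module _ (components : Components) where
      open Components components

      AnchorOf : Corner → Corner → Set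
      AnchorOf x z = OnAnchor (anchoring (rep x)) z

      AnchorOf-Conn : ∀ {x y z} → Conn I v x y → AnchorOf x z → AnchorOf y z
      AnchorOf-Conn {z = z} x~y = subst (λ r → OnAnchor (anchoring r) z) (rep-unique x~y)

      HasWalk : Corner → ℕ → Set
      HasWalk x n = ∃ λ z → AnchorOf x z × Walk x z n

      LeastWalk : Corner → Set
      LeastWalk x = ∃ λ n → HasWalk x n × ∀ {m} → m < n → ¬ HasWalk x m

      ¬¬least-walk : ∀ x → ¬ ¬ LeastWalk x
      ¬¬least-walk x with some-anchor (anchoring (rep x))
      ... | z , p , rep~z with walk-of (rep-Conn x ◅◅ rep~z)
      ...   | n , w = ¬¬-least (z , p , w)

      anchored-injective : ∀ {x y} (p : AnchorOf x x) (p' : AnchorOf y y) →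
                           anchorCube p ≡ anchorCube p' → x ≡ y
      anchored-injective {x} {y} p p' e = same-component (rep-unique (anchorCube-Conn p p' e)) p p' e
        where
        same-component : ∀ {r r'} → r ≡ r' →
                         (p : OnAnchor (anchoring r) x) (p' : OnAnchor (anchoring r') y) →
                         anchorCube p ≡ anchorCube p' → x ≡ y
        same-component refl = anchorCube-injective

      anchored-endpoint : ∀ {x y y'} (p : AnchorOf x x) → Joins I v (anchorCube p) y y' → AnchorOf y y
      anchored-endpoint p J with anchorCube-endpoint p J
      ... | p' , x~y = AnchorOf-Conn x~y p'

      module _ (least : ∀ x → LeastWalk x) where

        distance : Corner → ℕ
        distance x = proj₁ (least x)

        data Orientation (x : Corner) (i : Idx I) : Set where
          anchored : (p : AnchorOf x x) → anchorCube p ≡ i → Orientation x i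
          descends : ∀ {y} → Joins I v i x y → distance y < distance x → ¬ AnchorOf x x → Orientation x i

        orient : ∀ x {n} → distance x ≡ n → HasWalk x n → ∃ (Orientation x)
        orient x _ (z , p , []) = anchorCube p , anchored p refl
        orient x {suc n} d≡ (z , p , _∷_ {y = y} (i , J) rest) =
          i , descends J (subst (distance y <_) (sym d≡) (s≤s closer)) not-anchored
          where
          closer : distance y ≤ n
          closer = ℕ.≮⇒≥ λ n<d →
            proj₂ (proj₂ (least y)) n<d (z , AnchorOf-Conn ((i , J) ◅ ε) p , rest)

          not-anchored : ¬ AnchorOf x x
          not-anchored p' = proj₂ (proj₂ (least x)) (subst (0 <_) (sym d≡) (s≤s z≤n)) (x , p' , [])

        orientation : ∀ x → ∃ (Orientation x)
        orientation x = orient x refl (proj₁ (proj₂ (least x)))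

        orientation-injective : ∀ {x y i} → Orientation x i → Orientation y i → x ≡ y
        orientation-injective (anchored p refl) (anchored p' e) = anchored-injective p p' (sym e)
        orientation-injective (anchored p refl) (descends J _ not-anchored) =
          ⊥-elim (not-anchored (anchored-endpoint p J))
        orientation-injective (descends J _ not-anchored) (anchored p refl) =
          ⊥-elim (not-anchored (anchored-endpoint p J))
        orientation-injective (descends J closer _) (descends J' closer' _) with Joins-endpoints J J'
        ... | inj₁ (refl , _)    = refl
        ... | inj₂ (refl , refl) = ⊥-elim (ℕ.<-asym closer closer')

        orientation-covers : ∀ {x i} → Orientation x i → InT (cornerTriple v x) (lookup I i)
        orientation-covers (anchored p refl) = anchorCube-covers p
        orientation-covers (descends J _ _)  = Joins⇒InT J

        cover : Cover I v
        cover = record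
          { cube-at   = λ x → proj₁ (orientation x)
          ; injective = λ {x} {y} e → orientation-injective (proj₂ (orientation x))
                                        (subst (Orientation y) (sym e) (proj₂ (orientation y)))
          ; covers    = λ x → orientation-covers (proj₂ (orientation x))
          }

    -- Representatives, cycles and shortest walks are chosen classically; this is harmless because
    -- Cover is decidable (cover? below).
    ¬¬cover : ¬ ¬ Cover I v
    ¬¬cover = do
      components ← ¬¬components
      least      ← dns-corner (¬¬least-walk components)
      pure (cover components least)

  InT? : ∀ t q → Dec (InT t q)
  InT? t q = ∃-corner? λ k → cornerTriple q k ≟ᵗ t

  injective? : (a : Corner → Idx I) → Dec (Injective _≡_ _≡_ a)
  injective? a = map′ (λ h {x} {y} → h x y) (λ h x y → h)
    (∀-corner? λ x → ∀-corner? λ y → (a x Fin.≟ a y) →-dec (x ≟ᶜ y))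

  cover? : Dec (Cover I v)
  cover? = map′ (λ (as , a-injective , covers) → record
                   { cube-at = Vec.lookup as ∘ cornerIndex ; injective = a-injective ; covers = covers })
                tabulated
                (∃-vec? Fin.any? λ as → injective? (Vec.lookup as ∘ cornerIndex) ×-dec
                   ∀-corner? λ u → InT? (cornerTriple v u) (lookup I (Vec.lookup as (cornerIndex u))))
    where
    tabulated : (c : Cover I v) → ∃ λ as → let b = Vec.lookup as ∘ cornerIndex in
                Injective _≡_ _≡_ b × ∀ u → InT (cornerTriple v u) (lookup I (b u))
    tabulated c = Vec.tabulate (cube-at ∘ cornerAt) ,
                  (λ {x} {y} e → injective (trans (same x) (trans e (sym (same y))))) ,
                  (λ u → subst (λ i → InT (cornerTriple v u) (lookup I i)) (same u) (covers u))
      where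
      open Cover c
      same : ∀ k → cube-at k ≡ Vec.lookup (Vec.tabulate (cube-at ∘ cornerAt)) (cornerIndex k)
      same k = sym (trans (Vec.lookup∘tabulate (cube-at ∘ cornerAt) (cornerIndex k))
                          (cong cube-at (cornerAt-cornerIndex k)))

proposition4 : (I : Instance) (v : Cube) → Composable I v ⇔ TreeComponentsFit I v
proposition4 I v = mk⇔
  (λ composable → FromCover.fit (Composable⇒Cover I v composable))
  (λ (cube-of , special , coherent) →
     Cover⇒Composable I v (decidable-stable cover? (FromFit.¬¬cover cube-of special coherent)))
  where open Graph I v
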